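{- Let $q$ be a prime power and let $n,s$ be integers with $2<s<n$. Let $\Gamma$ be the graph whose vertices are the $2$-dimensional subspaces of $\mathbb{F}_q^n$, two distinct such subspaces being adjacent iff they intersect nontrivially. Let $S$ be an $s$-dimensional subspace of $\mathbb{F}_q^n$ and let $p_1,p_2$ be distinct $1$-dimensional subspaces of $S$. Let $C_1$ be the set of $2$-dimensional subspaces of $S$ containing $p_1$ but not $p_2$, and $C_2$ the set of $2$-dimensional subspaces of $S$ containing $p_2$ but not $p_1$. Then the graph $\overline{\Gamma}$ obtained from $\Gamma$ by switching with respect to $\{C_1,C_2\}$ is not isomorphic to $\Gamma$.
   Context: For a vertex $x$ of a graph $\Gamma$, $\Gamma(x)$ denotes its neighbourhood. For disjoint vertex subsets $C_1,C_2$ of $\Gamma$ with $D$ the set of remaining vertices, the graph $\overline{\Gamma}$ obtained by switching with respect to $\{C_1,C_2\}$ has the same vertex set, the same edges inside $C_1\cup C_2$ and inside $D$, and for $x\in D$: $\overline{\Gamma}(x)\cap(C_1\cup C_2)=C_1$ if $\Gamma(x)\cap(C_1\cup C_2)=C_2$; $=C_2$ if $\Gamma(x)\cap(C_1\cup C_2)=C_1$; and $=\Gamma(x)\cap(C_1\cup C_2)$ otherwise. -}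

module Defs where

open import Level using (0ℓ)
open import Data.Nat using (ℕ; zero; suc; _≤_; _^_)
open import Data.Nat.Primality using (Prime)
open import Data.Fin using (Fin; zero; suc)
open import Data.Product using (Σ; ∃; ∃-syntax; _×_; _,_)
open import Data.Sum using (_⊎_)
open import Relation.Nullary using (¬_)
open import Relation.Binary.PropositionalEquality using (_≡_)
open import Relation.Binary.Bundles using (Setoid)
open import Algebra.Bundles using (CommutativeRing)
open import Function.Bundles using (_⇔_)

IsPrimePower : ℕ → Set
IsPrimePower q = ∃[ p ] ∃[ k ] (Prime p × 1 ≤ k × q ≡ p ^ k)

record IsFiniteField (R : CommutativeRing 0ℓ 0ℓ) (q : ℕ) : Set where
  open CommutativeRing R hiding (zero)
  field
    1≉0      : ¬ (1# ≈ 0#)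
    inverse  : ∀ x → ¬ (x ≈ 0#) → ∃[ y ] (x * y ≈ 1#)
    enum     : Fin q → Carrier
    enum-inj : ∀ i j → enum i ≈ enum j → i ≡ j
    enum-sur : ∀ x → ∃[ i ] (enum i ≈ x)

record Graph : Set₁ where
  field
    V   : Setoid 0ℓ 0ℓ
    Adj : Setoid.Carrier V → Setoid.Carrier V → Set

record Iso (G H : Graph) : Set where
  private
    module G = Graph G
    module H = Graph H
    module VG = Setoid G.V
    module VH = Setoid H.V
  field
    f        : VG.Carrier → VH.Carrier
    f-cong   : ∀ x y → x VG.≈ y → f x VH.≈ f y
    f-inj    : ∀ x y → f x VH.≈ f y → x VG.≈ y
    f-sur    : ∀ y → ∃[ x ] (f x VH.≈ y)
    f-adj    : ∀ x y → G.Adj x y ⇔ H.Adj (f x) (f y)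

module _ (G : Graph) where
  open Graph G
  private V₀ = Setoid.Carrier V

  module Switch (C₁ C₂ : V₀ → Set) where
    InC : V₀ → Set
    InC z = C₁ z ⊎ C₂ z

    InD : V₀ → Set
    InD z = ¬ InC z

    NbC≐ : V₀ → (V₀ → Set) → Set
    NbC≐ x P = ∀ z → InC z → (Adj x z ⇔ P z)

    Cross : V₀ → V₀ → Set
    Cross x y = (NbC≐ x C₂ × C₁ y)
              ⊎ (NbC≐ x C₁ × C₂ y)
              ⊎ (¬ NbC≐ x C₂ × ¬ NbC≐ x C₁ × Adj x y)

    AdjSw : V₀ → V₀ → Set
    AdjSw x y = (InC x × InC y × Adj x y)
              ⊎ (InD x × InD y × Adj x y)
              ⊎ (InD x × InC y × Cross x y)
              ⊎ (InC x × InD y × Cross y x)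

switch : (G : Graph) → (Setoid.Carrier (Graph.V G) → Set)
       → (Setoid.Carrier (Graph.V G) → Set) → Graph
switch G C₁ C₂ = record { V = Graph.V G ; Adj = Switch.AdjSw G C₁ C₂ }

module LinAlg (R : CommutativeRing 0ℓ 0ℓ) (n : ℕ) where
  open CommutativeRing R hiding (zero)

  Vect : Set
  Vect = Fin n → Carrier

  _≈ᵥ_ : Vect → Vect → Set
  u ≈ᵥ v = ∀ i → u i ≈ v i

  IsZero : Vect → Set
  IsZero w = ∀ i → w i ≈ 0#

  lincomb : ∀ {k} → (Fin k → Carrier) → (Fin k → Vect) → Vect
  lincomb {zero}  c b i = 0#
  lincomb {suc k} c b i = c zero * b zero i + lincomb (λ j → c (suc j)) (λ j → b (suc j)) i

  InSpan : ∀ {k} → (Fin k → Vect) → Vect → Set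
  InSpan {k} b w = ∃[ c ] (w ≈ᵥ lincomb {k} c b)

  LinIndep : ∀ {k} → (Fin k → Vect) → Set
  LinIndep {k} b = ∀ (c : Fin k → Carrier) → IsZero (lincomb c b) → ∀ j → c j ≈ 0#

  record Sub2 : Set where
    constructor sub2
    field
      basis : Fin 2 → Vect
      indep : LinIndep basis

  _∈₂_ : Vect → Sub2 → Set
  w ∈₂ X = InSpan (Sub2.basis X) w

  -- two bases represent the same subspace iff they have the same span
  _≈₂_ : Sub2 → Sub2 → Set
  X ≈₂ Y = (∀ w → w ∈₂ X → w ∈₂ Y) × (∀ w → w ∈₂ Y → w ∈₂ X)

  Sub2-setoid : Setoid 0ℓ 0ℓ
  Sub2-setoid = record
    { Carrier = Sub2
    ; _≈_ = _≈₂_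
    ; isEquivalence = record
      { refl = (λ w p → p) , (λ w p → p)
      ; sym = λ { (a , b) → b , a }
      ; trans = λ { (a , b) (c , d) → (λ w p → c w (a w p)) , (λ w p → b w (d w p)) }
      }
    }

  Adj₂ : Sub2 → Sub2 → Set
  Adj₂ X Y = ¬ (X ≈₂ Y) × ∃[ w ] (¬ IsZero w × w ∈₂ X × w ∈₂ Y)

  Γ₂ : Graph
  Γ₂ = record { V = Sub2-setoid ; Adj = Adj₂ }

  _⊆span_ : ∀ {k} → Sub2 → (Fin k → Vect) → Set
  X ⊆span b = ∀ w → w ∈₂ X → InSpan b w

  Cset : ∀ {k} → (Fin k → Vect) → Vect → Vect → Sub2 → Set
  Cset b p p' X = X ⊆span b × p ∈₂ X × ¬ (p' ∈₂ X)

module Submission where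

-- In Γ an edge X Y (two planes meeting in ⟨r⟩) has no three distinct,
-- pairwise non-adjacent common neighbours: at most one of them contains r,
-- and a plane avoiding r that meets both X and Y lies in the 3-space X + Y,
-- where any two planes meet.  The switched graph does contain such a
-- configuration.  Take u ∈ S ∖ ⟨p₁, p₂⟩ and v ∉ S, which exist by the
-- exchange lemma as s > 2 and n > s.  Among C₁ ∪ C₂ the plane X = ⟨p₁, v⟩ is
-- adjacent exactly to C₁, so switching joins it to C = ⟨p₂, u⟩ ∈ C₂.  The
-- planes ⟨p₁, p₂⟩, ⟨v, u⟩ and ⟨p₁ + v, p₂ + u⟩ lie outside C₁ ∪ C₂, pairwise
-- meet trivially and are adjacent to X; they stay adjacent to C because each
-- is adjacent to members of both C₁ and C₂.

open import Defs
open import Algebra.Bundles using (CommutativeRing)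
open import Data.Bool using (Bool; true; false; T; _∧_; not)
open import Data.Empty using (⊥; ⊥-elim)
open import Data.Fin using (Fin; zero; suc; punchIn)
open import Data.Fin.Properties using (all?; ¬∀⟶∃¬)
open import Data.Integer as ℤ using (ℤ; +_; -[1+_]; _⊖_; _◃_; sign; ∣_∣)
import Data.Integer.Properties as ℤ
open import Data.Maybe using (Maybe; just; nothing)
open import Data.Nat using (ℕ; _<_)
import Data.Nat as ℕ
import Data.Nat.Properties as ℕ
open import Data.Product using (_×_; ∃-syntax; _,_; proj₁; proj₂)
open import Data.Sign as Sign using (Sign)
open import Data.Sum using (inj₁; inj₂)
open import Data.Vec.Functional using ([]; _∷_; insertAt; removeAt)
open import Data.Vec.Functional.Properties using (insertAt-lookup; insertAt-punchIn; removeAt-insertAt)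
open import Function using (_∘_)
open import Function.Bundles using (mk⇔; Equivalence)
open import Level using (0ℓ)
open import Relation.Binary.Bundles using (Setoid)
open import Relation.Binary.Definitions using (Decidable)
open import Relation.Binary.PropositionalEquality as ≡ using (_≡_; _≢_)
open import Relation.Nullary using (¬_; Dec; yes; no)
open import Relation.Nullary.Decidable using (decidable-stable; ¬¬-excluded-middle)

-- The canonical homomorphism ℤ → R lets the ring solver with integer
-- coefficients work in an arbitrary commutative ring.
module IntegerCoefficients (R : CommutativeRing 0ℓ 0ℓ) where
  open CommutativeRing R
  open import Algebra.Properties.Ring ring using (-‿involutive; -‿distribˡ-*; -‿distribʳ-*; -0#≈0#; -‿+-comm)
  open import Algebra.Properties.Semiring.Mult semiring using (×-homo-+; ×1-homo-*) renaming (_×_ to _ℕ×_)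
  open import Algebra.Properties.CommutativeSemigroup *-commutativeSemigroup using (interchange)
  open import Algebra.Solver.Ring.AlmostCommutativeRing
  open import Relation.Binary.Reasoning.Setoid setoid

  fromℕ : ℕ → Carrier
  fromℕ m = m ℕ× 1#

  fromℤ : ℤ → Carrier
  fromℤ (+ m)      = fromℕ m
  fromℤ -[1+ m ]   = - fromℕ (ℕ.suc m)

  fromSign : Sign → Carrier
  fromSign Sign.+ = 1#
  fromSign Sign.- = - 1#

  1+a-[1+b]≈a-b : ∀ a b → (1# + a) + - (1# + b) ≈ a + - b
  1+a-[1+b]≈a-b a b = begin
    (1# + a) + - (1# + b)    ≈⟨ +-congˡ (sym (-‿+-comm 1# b)) ⟩
    (1# + a) + (- 1# + - b)  ≈⟨ +-assoc _ _ _ ⟩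
    1# + (a + (- 1# + - b))  ≈⟨ +-congˡ (sym (+-assoc _ _ _)) ⟩
    1# + ((a + - 1#) + - b)  ≈⟨ +-congˡ (+-congʳ (+-comm _ _)) ⟩
    1# + ((- 1# + a) + - b)  ≈⟨ +-congˡ (+-assoc _ _ _) ⟩
    1# + (- 1# + (a + - b))  ≈⟨ sym (+-assoc _ _ _) ⟩
    (1# + - 1#) + (a + - b)  ≈⟨ +-congʳ (-‿inverseʳ _) ⟩
    0# + (a + - b)           ≈⟨ +-identityˡ _ ⟩
    a + - b                  ∎

  ⊖-homo : ∀ m n → fromℤ (m ⊖ n) ≈ fromℕ m + - fromℕ n
  ⊖-homo ℕ.zero    ℕ.zero    = sym (trans (+-identityˡ _) -0#≈0#)
  ⊖-homo (ℕ.suc m) ℕ.zero    = sym (trans (+-congˡ -0#≈0#) (+-identityʳ _))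
  ⊖-homo ℕ.zero    (ℕ.suc n) = sym (+-identityˡ _)
  ⊖-homo (ℕ.suc m) (ℕ.suc n) = begin
    fromℤ (ℕ.suc m ⊖ ℕ.suc n)                 ≡⟨ ≡.cong fromℤ (ℤ.[1+m]⊖[1+n]≡m⊖n m n) ⟩
    fromℤ (m ⊖ n)                             ≈⟨ ⊖-homo m n ⟩
    fromℕ m + - fromℕ n                       ≈⟨ sym (1+a-[1+b]≈a-b _ _) ⟩
    fromℕ (ℕ.suc m) + - fromℕ (ℕ.suc n)       ∎

  +-homo : ∀ i j → fromℤ (i ℤ.+ j) ≈ fromℤ i + fromℤ j
  +-homo (+ m)    (+ n)    = ×-homo-+ 1# m n
  +-homo (+ m)    -[1+ n ] = ⊖-homo m (ℕ.suc n)
  +-homo -[1+ m ] (+ n)    = trans (⊖-homo n (ℕ.suc m)) (+-comm _ _)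
  +-homo -[1+ m ] -[1+ n ] = begin
    - fromℕ (ℕ.suc (ℕ.suc (m ℕ.+ n)))         ≡⟨ ≡.cong (λ k → - fromℕ (ℕ.suc k)) (≡.sym (ℕ.+-suc m n)) ⟩
    - fromℕ (ℕ.suc m ℕ.+ ℕ.suc n)             ≈⟨ -‿cong (×-homo-+ 1# (ℕ.suc m) (ℕ.suc n)) ⟩
    - (fromℕ (ℕ.suc m) + fromℕ (ℕ.suc n))     ≈⟨ sym (-‿+-comm _ _) ⟩
    - fromℕ (ℕ.suc m) + - fromℕ (ℕ.suc n)     ∎

  ◃-homo : ∀ s m → fromℤ (s ◃ m) ≈ fromSign s * fromℕ m
  ◃-homo s      ℕ.zero    = sym (zeroʳ _)
  ◃-homo Sign.+ (ℕ.suc m) = sym (*-identityˡ _)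
  ◃-homo Sign.- (ℕ.suc m) = trans (-‿cong (sym (*-identityˡ _))) (-‿distribˡ-* _ _)

  fromSign-homo : ∀ s t → fromSign (s Sign.* t) ≈ fromSign s * fromSign t
  fromSign-homo Sign.+ t      = sym (*-identityˡ _)
  fromSign-homo Sign.- Sign.+ = sym (*-identityʳ _)
  fromSign-homo Sign.- Sign.- = begin
    1#             ≈⟨ sym (-‿involutive _) ⟩
    - - 1#         ≈⟨ -‿cong (sym (*-identityʳ _)) ⟩
    - (- 1# * 1#)  ≈⟨ -‿distribʳ-* _ _ ⟩
    - 1# * - 1#    ∎

  sign-abs : ∀ i → fromℤ i ≈ fromSign (sign i) * fromℕ ∣ i ∣
  sign-abs (+ n)    = sym (*-identityˡ _)
  sign-abs -[1+ n ] = ◃-homo Sign.- (ℕ.suc n)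

  *-homo : ∀ i j → fromℤ (i ℤ.* j) ≈ fromℤ i * fromℤ j
  *-homo i j = begin
    fromℤ (i ℤ.* j)                                  ≈⟨ ◃-homo (sign i Sign.* sign j) (∣ i ∣ ℕ.* ∣ j ∣) ⟩
    fromSign (sign i Sign.* sign j) * fromℕ (∣ i ∣ ℕ.* ∣ j ∣)
      ≈⟨ *-cong (fromSign-homo (sign i) (sign j)) (×1-homo-* ∣ i ∣ ∣ j ∣) ⟩
    (fromSign (sign i) * fromSign (sign j)) * (fromℕ ∣ i ∣ * fromℕ ∣ j ∣)
      ≈⟨ interchange _ _ _ _ ⟩
    (fromSign (sign i) * fromℕ ∣ i ∣) * (fromSign (sign j) * fromℕ ∣ j ∣)
      ≈⟨ *-cong (sym (sign-abs i)) (sym (sign-abs j)) ⟩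
    fromℤ i * fromℤ j                                ∎

  -‿homo : ∀ i → fromℤ (ℤ.- i) ≈ - fromℤ i
  -‿homo -[1+ n ]      = sym (-‿involutive _)
  -‿homo (+ ℕ.zero)    = sym -0#≈0#
  -‿homo (+ ℕ.suc n)   = refl

  homomorphism : ℤ.+-*-rawRing -Raw-AlmostCommutative⟶ fromCommutativeRing R
  homomorphism = record
    { ⟦_⟧ = fromℤ ; +-homo = +-homo ; *-homo = *-homo ; -‿homo = -‿homo
    ; 0-homo = refl ; 1-homo = +-identityʳ _ }

  fromℤ-≟ : ∀ i j → Maybe (fromℤ i ≈ fromℤ j)
  fromℤ-≟ i j with i ℤ.≟ j
  ... | yes ≡.refl = just refl
  ... | no _       = nothing

  open import Algebra.Solver.Ring ℤ.+-*-rawRing (fromCommutativeRing R) homomorphism fromℤ-≟ public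
    using (solve; con; _:+_; _:*_; :-_; _:=_)

module _ (G : Graph) where
  open Graph G
  open Setoid V renaming (Carrier to Vertex)

  AdjRespects≈ : Set
  AdjRespects≈ = ∀ x x′ y y′ → x ≈ x′ → y ≈ y′ → Adj x y → Adj x′ y′

  record InducedK113 : Set where
    field
      x y : Vertex
      z   : Fin 3 → Vertex
      x~y : Adj x y
      z~x : ∀ i → Adj (z i) x
      z~y : ∀ i → Adj (z i) y
      z≁z : ∀ {i j} → i ≢ j → ¬ Adj (z i) (z j)
      z≉z : ∀ {i j} → i ≢ j → ¬ z i ≈ z j

InducedK113-pullback : ∀ {G H} → Iso G H → AdjRespects≈ H → InducedK113 H → InducedK113 G
InducedK113-pullback {G} {H} iso H-resp K = record
  { x = pre x ; y = pre y ; z = pre ∘ z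
  ; x~y = reflect x~y
  ; z~x = λ i → reflect (z~x i)
  ; z~y = λ i → reflect (z~y i)
  ; z≁z = λ i≢j → z≁z i≢j ∘ preserve
  ; z≉z = λ i≢j → z≉z i≢j ∘ λ eq → H.trans (H.sym (f∘pre _)) (H.trans (f-cong _ _ eq) (f∘pre _))
  }
  where
  open Iso iso
  open InducedK113 K
  module H = Setoid (Graph.V H)
  pre = λ v → proj₁ (f-sur v)
  f∘pre = λ v → proj₂ (f-sur v)
  reflect : ∀ {a b} → Graph.Adj H a b → Graph.Adj G (pre a) (pre b)
  reflect a~b = Equivalence.from (f-adj _ _) (H-resp _ _ _ _ (H.sym (f∘pre _)) (H.sym (f∘pre _)) a~b)
  preserve : ∀ {a b} → Graph.Adj G (pre a) (pre b) → Graph.Adj H a b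
  preserve a~b = H-resp _ _ _ _ (f∘pre _) (f∘pre _) (Equivalence.to (f-adj _ _) a~b)

module _ (G : Graph) (G-resp : AdjRespects≈ G) where
  open Graph G
  open Setoid V renaming (Carrier to Vertex)

  module _ (C₁ C₂ : Vertex → Set)
           (C₁-resp : ∀ x y → x ≈ y → C₁ x → C₁ y) (C₂-resp : ∀ x y → x ≈ y → C₂ x → C₂ y) where
    open Switch G C₁ C₂

    private
      InC-resp : ∀ {x y} → x ≈ y → InC x → InC y
      InC-resp x≈y (inj₁ c₁) = inj₁ (C₁-resp _ _ x≈y c₁)
      InC-resp x≈y (inj₂ c₂) = inj₂ (C₂-resp _ _ x≈y c₂)

      InD-resp : ∀ {x y} → x ≈ y → InD x → InD y
      InD-resp x≈y x∉C y∈C = x∉C (InC-resp (sym x≈y) y∈C)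

      NbC≐-resp : ∀ {x y} P → x ≈ y → NbC≐ x P → NbC≐ y P
      NbC≐-resp P x≈y nb z z∈C = mk⇔ (Equivalence.to (nb z z∈C) ∘ G-resp _ _ _ _ (sym x≈y) refl)
                                     (G-resp _ _ _ _ x≈y refl ∘ Equivalence.from (nb z z∈C))

      Cross-resp : ∀ {x x′ y y′} → x ≈ x′ → y ≈ y′ → Cross x y → Cross x′ y′
      Cross-resp x≈ y≈ (inj₁ (nb , c₁))        = inj₁ (NbC≐-resp C₂ x≈ nb , C₁-resp _ _ y≈ c₁)
      Cross-resp x≈ y≈ (inj₂ (inj₁ (nb , c₂))) = inj₂ (inj₁ (NbC≐-resp C₁ x≈ nb , C₂-resp _ _ y≈ c₂))
      Cross-resp x≈ y≈ (inj₂ (inj₂ (¬nb₂ , ¬nb₁ , x~y))) =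
        inj₂ (inj₂ (¬nb₂ ∘ NbC≐-resp C₂ (sym x≈) , ¬nb₁ ∘ NbC≐-resp C₁ (sym x≈) , G-resp _ _ _ _ x≈ y≈ x~y))

    switch-respects : AdjRespects≈ (switch G C₁ C₂)
    switch-respects _ _ _ _ x≈ y≈ (inj₁ (cx , cy , x~y)) =
      inj₁ (InC-resp x≈ cx , InC-resp y≈ cy , G-resp _ _ _ _ x≈ y≈ x~y)
    switch-respects _ _ _ _ x≈ y≈ (inj₂ (inj₁ (dx , dy , x~y))) =
      inj₂ (inj₁ (InD-resp x≈ dx , InD-resp y≈ dy , G-resp _ _ _ _ x≈ y≈ x~y))
    switch-respects _ _ _ _ x≈ y≈ (inj₂ (inj₂ (inj₁ (dx , cy , cross)))) =
      inj₂ (inj₂ (inj₁ (InD-resp x≈ dx , InC-resp y≈ cy , Cross-resp x≈ y≈ cross)))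
    switch-respects _ _ _ _ x≈ y≈ (inj₂ (inj₂ (inj₂ (cx , dy , cross)))) =
      inj₂ (inj₂ (inj₂ (InC-resp x≈ cx , InD-resp y≈ dy , Cross-resp y≈ x≈ cross)))

module _ (G : Graph) (C₁ C₂ : Setoid.Carrier (Graph.V G) → Set) where
  open Graph G
  open Switch G C₁ C₂

  AdjSw-within-D : ∀ {x y} → InD x → InD y → AdjSw x y → Adj x y
  AdjSw-within-D x∈D y∈D (inj₁ (x∈C , _))                 = ⊥-elim (x∈D x∈C)
  AdjSw-within-D x∈D y∈D (inj₂ (inj₁ (_ , _ , x~y)))       = x~y
  AdjSw-within-D x∈D y∈D (inj₂ (inj₂ (inj₁ (_ , y∈C , _)))) = ⊥-elim (y∈D y∈C)
  AdjSw-within-D x∈D y∈D (inj₂ (inj₂ (inj₂ (x∈C , _))))     = ⊥-elim (x∈D x∈C)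

pairwise-Fin3 : ∀ {A : Set} (R : A → A → Set) → (∀ a b → R a b → R b a) → ∀ a₀ a₁ a₂ →
                ¬ R a₀ a₁ → ¬ R a₀ a₂ → ¬ R a₁ a₂ →
                ∀ {i j} → i ≢ j → ¬ R ((a₀ ∷ a₁ ∷ a₂ ∷ []) i) ((a₀ ∷ a₁ ∷ a₂ ∷ []) j)
pairwise-Fin3 R R-sym a₀ a₁ a₂ ¬01 ¬02 ¬12 = pairwise
  where
  a = a₀ ∷ a₁ ∷ a₂ ∷ []
  pairwise : ∀ {i j} → i ≢ j → ¬ R (a i) (a j)
  pairwise {zero}           {zero}           0≢0 = ⊥-elim (0≢0 ≡.refl)
  pairwise {zero}           {suc zero}       _   = ¬01
  pairwise {zero}           {suc (suc zero)} _   = ¬02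
  pairwise {suc zero}       {zero}           _   = ¬01 ∘ R-sym _ _
  pairwise {suc zero}       {suc zero}       1≢1 = ⊥-elim (1≢1 ≡.refl)
  pairwise {suc zero}       {suc (suc zero)} _   = ¬12
  pairwise {suc (suc zero)} {zero}           _   = ¬02 ∘ R-sym _ _
  pairwise {suc (suc zero)} {suc zero}       _   = ¬12 ∘ R-sym _ _
  pairwise {suc (suc zero)} {suc (suc zero)} 2≢2 = ⊥-elim (2≢2 ≡.refl)

¬¬-∀-Fin : ∀ {m} {P : Fin m → Set} → (∀ j → ¬ ¬ P j) → ¬ ¬ (∀ j → P j)
¬¬-∀-Fin {ℕ.zero}  ¬¬P ¬∀P = ¬∀P λ ()
¬¬-∀-Fin {ℕ.suc m} ¬¬P ¬∀P =
  ¬¬P zero λ P₀ → ¬¬-∀-Fin (¬¬P ∘ suc) λ P₊ → ¬∀P λ { zero → P₀ ; (suc j) → P₊ j }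

two-of-three-fail : (P : Fin 3 → Set) → (∀ {i j} → i ≢ j → P i → P j → ⊥) →
                    ¬ ¬ (∃[ i ] ∃[ j ] (i ≢ j × ¬ P i × ¬ P j))
two-of-three-fail P exclusive none-two = ¬¬-excluded-middle λ p₀? → ¬¬-excluded-middle λ p₁? → pick p₀? p₁?
  where
  pick : Dec (P zero) → Dec (P (suc zero)) → ⊥
  pick (yes p₀) (yes p₁) = exclusive {zero} {suc zero} (λ ()) p₀ p₁
  pick (yes p₀) (no ¬p₁) = none-two (suc zero , suc (suc zero) , (λ ()) , ¬p₁ , exclusive {zero} {suc (suc zero)} (λ ()) p₀)
  pick (no ¬p₀) (yes p₁) = none-two (zero , suc (suc zero) , (λ ()) , ¬p₀ , exclusive {suc zero} {suc (suc zero)} (λ ()) p₁)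
  pick (no ¬p₀) (no ¬p₁) = none-two (zero , suc zero , (λ ()) , ¬p₀ , ¬p₁)

record IsDiscreteField (F : CommutativeRing 0ℓ 0ℓ) : Set where
  open CommutativeRing F
  field
    _≟_     : Decidable _≈_
    1≉0     : ¬ 1# ≈ 0#
    inverse : ∀ x → ¬ x ≈ 0# → ∃[ y ] (x * y ≈ 1#)

finite⇒discrete : ∀ {F q} → IsFiniteField F q → IsDiscreteField F
finite⇒discrete {F} ff = record { _≟_ = _≟_ ; 1≉0 = 1≉0 ; inverse = inverse }
  where
  open CommutativeRing F
  open IsFiniteField ff
  _≟_ : Decidable _≈_
  x ≟ y with enum-sur x | enum-sur y
  ... | i , i↦x | j , j↦y with i Data.Fin.≟ j
  ...   | yes ≡.refl = yes (trans (sym i↦x) j↦y)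
  ...   | no i≢j     = no λ x≈y → i≢j (enum-inj i j (trans i↦x (trans x≈y (sym j↦y))))

module Vectors (F : CommutativeRing 0ℓ 0ℓ) (n : ℕ) where
  open CommutativeRing F hiding (zero)
  open LinAlg F n
  open import Algebra.Properties.Ring ring using (-1*x≈-x)
  open import Algebra.Properties.Semiring.Sum semiring using (sum; sum-remove; sum-cong-≋; sum-replicate-zero)
  open import Relation.Binary.Reasoning.Setoid setoid
  open IntegerCoefficients F using (solve; con; _:+_; _:*_; :-_; _:=_)

  infixl 6 _+ᵥ_
  infixr 7 _·ᵥ_

  _+ᵥ_ : Vect → Vect → Vect
  (u +ᵥ v) i = u i + v i

  _·ᵥ_ : Carrier → Vect → Vect
  (a ·ᵥ u) i = a * u i

  lincomb-at : ∀ {k} (c : Fin k → Carrier) (e : Fin k → Vect) i → lincomb c e i ≡ sum (λ j → c j * e j i)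
  lincomb-at {ℕ.zero}  c e i = ≡.refl
  lincomb-at {ℕ.suc k} c e i = ≡.cong (_+_ (c zero * e zero i)) (lincomb-at (c ∘ suc) (e ∘ suc) i)

  lincomb-cong : ∀ {k} {c d : Fin k → Carrier} (e : Fin k → Vect) → (∀ j → c j ≈ d j) → lincomb c e ≈ᵥ lincomb d e
  lincomb-cong {ℕ.zero}  e c≈d i = refl
  lincomb-cong {ℕ.suc k} e c≈d i = +-cong (*-congʳ (c≈d zero)) (lincomb-cong (e ∘ suc) (c≈d ∘ suc) i)

  lincomb-+ : ∀ {k} (c d : Fin k → Carrier) (e : Fin k → Vect) →
              lincomb (λ j → c j + d j) e ≈ᵥ (lincomb c e +ᵥ lincomb d e)
  lincomb-+ {ℕ.zero}  c d e i = sym (+-identityʳ _)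
  lincomb-+ {ℕ.suc k} c d e i = trans (+-cong (distribʳ _ _ _) (lincomb-+ (c ∘ suc) (d ∘ suc) (e ∘ suc) i))
                                       (interchange _ _ _ _)
    where open import Algebra.Properties.CommutativeSemigroup +-commutativeSemigroup using (interchange)

  lincomb-* : ∀ {k} a (c : Fin k → Carrier) (e : Fin k → Vect) → lincomb (λ j → a * c j) e ≈ᵥ (a ·ᵥ lincomb c e)
  lincomb-* {ℕ.zero}  a c e i = sym (zeroʳ _)
  lincomb-* {ℕ.suc k} a c e i = trans (+-cong (*-assoc _ _ _) (lincomb-* a (c ∘ suc) (e ∘ suc) i)) (sym (distribˡ _ _ _))

  lincomb-0 : ∀ {k} {c : Fin k → Carrier} (e : Fin k → Vect) → (∀ j → c j ≈ 0#) → IsZero (lincomb c e)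
  lincomb-0 {ℕ.zero}  e c≈0 i = refl
  lincomb-0 {ℕ.suc k} e c≈0 i = trans (+-cong (trans (*-congʳ (c≈0 zero)) (zeroˡ _)) (lincomb-0 (e ∘ suc) (c≈0 ∘ suc) i))
                                      (+-identityʳ _)

  lincomb-swap : ∀ α β x y → lincomb (α ∷ β ∷ []) (x ∷ y ∷ []) ≈ᵥ lincomb (β ∷ α ∷ []) (y ∷ x ∷ [])
  lincomb-swap α β x y i = trans (+-congˡ (+-identityʳ _)) (trans (+-comm _ _) (sym (+-congˡ (+-identityʳ _))))

  δ : ∀ {k} → Fin k → Fin k → Carrier
  δ zero    zero    = 1#
  δ zero    (suc _) = 0#
  δ (suc _) zero    = 0#
  δ (suc i) (suc j) = δ i j

  sum-δ : ∀ {k} (i : Fin k) (x : Fin k → Carrier) → sum (λ j → δ i j * x j) ≈ x i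
  sum-δ {ℕ.suc k} zero x = begin
    1# * x zero + sum (λ j → 0# * x (suc j))  ≈⟨ +-cong (*-identityˡ _) (sum-cong-≋ {k} (λ j → zeroˡ (x (suc j)))) ⟩
    x zero + sum {k} (λ _ → 0#)               ≈⟨ +-congˡ (sum-replicate-zero k) ⟩
    x zero + 0#                               ≈⟨ +-identityʳ _ ⟩
    x zero                                    ∎
  sum-δ (suc i) x  = trans (+-cong (zeroˡ _) (sum-δ i (x ∘ suc))) (+-identityˡ _)

  lincomb-δ : ∀ {k} (j : Fin k) (e : Fin k → Vect) → lincomb (δ j) e ≈ᵥ e j
  lincomb-δ j e i = trans (reflexive (lincomb-at (δ j) e i)) (sum-δ j (λ l → e l i))

  δ-sym : ∀ {k} (i j : Fin k) → δ i j ≡ δ j i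
  δ-sym zero    zero    = ≡.refl
  δ-sym zero    (suc _) = ≡.refl
  δ-sym (suc _) zero    = ≡.refl
  δ-sym (suc i) (suc j) = δ-sym i j

  𝕖 : Fin n → Vect
  𝕖 = δ

  lincomb-𝕖 : (c : Fin n → Carrier) → lincomb c 𝕖 ≈ᵥ c
  lincomb-𝕖 c i = begin
    lincomb c 𝕖 i             ≡⟨ lincomb-at c 𝕖 i ⟩
    sum (λ j → c j * δ j i)   ≈⟨ sum-cong-≋ (λ j → trans (*-comm _ _) (*-congʳ (reflexive (δ-sym j i)))) ⟩
    sum (λ j → δ i j * c j)   ≈⟨ sum-δ i c ⟩
    c i                       ∎

  𝕖-independent : LinIndep 𝕖
  𝕖-independent c c𝕖≈0 i = trans (sym (lincomb-𝕖 c i)) (c𝕖≈0 i)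

  module _ {k} (e : Fin k → Vect) where

    InSpan-resp : ∀ {u v} → u ≈ᵥ v → InSpan e u → InSpan e v
    InSpan-resp u≈v (c , u≈ce) = c , λ i → trans (sym (u≈v i)) (u≈ce i)

    InSpan-zero : ∀ {u} → IsZero u → InSpan e u
    InSpan-zero u≈0 = (λ _ → 0#) , λ i → trans (u≈0 i) (sym (lincomb-0 e (λ _ → refl) i))

    InSpan-+ : ∀ {u v} → InSpan e u → InSpan e v → InSpan e (u +ᵥ v)
    InSpan-+ (c , u≈ce) (d , v≈de) = (λ j → c j + d j) , λ i → trans (+-cong (u≈ce i) (v≈de i)) (sym (lincomb-+ c d e i))

    InSpan-· : ∀ a {u} → InSpan e u → InSpan e (a ·ᵥ u)
    InSpan-· a (c , u≈ce) = (λ j → a * c j) , λ i → trans (*-congˡ (u≈ce i)) (sym (lincomb-* a c e i))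

    InSpan-member : ∀ j → InSpan e (e j)
    InSpan-member j = δ j , λ i → sym (lincomb-δ j e i)

    InSpan-lincomb : ∀ {l} (c : Fin l → Carrier) (w : Fin l → Vect) → (∀ j → InSpan e (w j)) → InSpan e (lincomb c w)
    InSpan-lincomb {ℕ.zero}  c w w⊆e = InSpan-zero (λ i → refl)
    InSpan-lincomb {ℕ.suc l} c w w⊆e = InSpan-+ (InSpan-· (c zero) (w⊆e zero)) (InSpan-lincomb (c ∘ suc) (w ∘ suc) (w⊆e ∘ suc))

    InSpan-⊆ : ∀ {l} (w : Fin l → Vect) → (∀ j → InSpan e (w j)) → ∀ {u} → InSpan w u → InSpan e u
    InSpan-⊆ w w⊆e (c , u≈cw) = InSpan-resp (λ i → sym (u≈cw i)) (InSpan-lincomb c w w⊆e)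

    InSpan-cancelˡ : ∀ {u v} → InSpan e u → InSpan e (u +ᵥ v) → InSpan e v
    InSpan-cancelˡ {u} {v} u∈e u+v∈e = InSpan-resp v≈ (InSpan-+ u+v∈e (InSpan-· (- 1#) u∈e))
      where
      v≈ : ((u +ᵥ v) +ᵥ (- 1#) ·ᵥ u) ≈ᵥ v
      v≈ i = trans (+-congˡ (-1*x≈-x _)) (solve 2 (λ u v → (u :+ v) :+ :- u := v) refl (u i) (v i))

  lincomb-insertAt : ∀ {m} (d : Fin m → Carrier) (j : Fin (ℕ.suc m)) x (w : Fin (ℕ.suc m) → Vect) →
                     lincomb (insertAt d j x) w ≈ᵥ (x ·ᵥ w j +ᵥ lincomb d (removeAt w j))
  lincomb-insertAt d j x w i = begin
    lincomb (insertAt d j x) w i                                     ≡⟨ lincomb-at (insertAt d j x) w i ⟩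
    sum (λ l → insertAt d j x l * w l i)                             ≈⟨ sum-remove {i = j} (λ l → insertAt d j x l * w l i) ⟩
    insertAt d j x j * w j i + sum (λ t → insertAt d j x (punchIn j t) * w (punchIn j t) i)
      ≈⟨ +-cong (*-congʳ (reflexive (insertAt-lookup d j x)))
                (sum-cong-≋ (λ t → *-congʳ (reflexive (removeAt-insertAt d j x t)))) ⟩
    x * w j i + sum (λ t → d t * w (punchIn j t) i)                 ≡⟨ ≡.cong (_+_ (x * w j i)) (≡.sym (lincomb-at d (removeAt w j) i)) ⟩
    x * w j i + lincomb d (removeAt w j) i                           ∎

  lincomb-shear : ∀ {m} (d a : Fin m → Carrier) (u : Fin m → Vect) (v : Vect) →
                  lincomb d (λ t → u t +ᵥ a t ·ᵥ v) ≈ᵥ (lincomb d u +ᵥ sum (λ t → d t * a t) ·ᵥ v)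
  lincomb-shear {ℕ.zero}  d a u v i = sym (trans (+-congˡ (zeroˡ _)) (+-identityʳ _))
  lincomb-shear {ℕ.suc m} d a u v i =
    trans (+-congˡ (lincomb-shear (d ∘ suc) (a ∘ suc) (u ∘ suc) v i))
          (solve 6 (λ d u a v L S → d :* (u :+ a :* v) :+ (L :+ S :* v) := (d :* u :+ L) :+ (d :* a :+ S) :* v)
                 refl _ _ _ _ _ _)

  LinIndep-shear : ∀ {m} {w : Fin (ℕ.suc m) → Vect} → LinIndep w → ∀ j (a : Fin m → Carrier) →
                   LinIndep (λ t → removeAt w j t +ᵥ a t ·ᵥ w j)
  LinIndep-shear {w = w} w-indep j a d d·w′≈0 t =
    trans (sym (reflexive (insertAt-punchIn d j x t)))
          (w-indep (insertAt d j x) (λ i → trans (lincomb-insertAt d j x w i) (trans (+-comm _ _)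
                                           (trans (sym (lincomb-shear d a (removeAt w j) (w j) i)) (d·w′≈0 i))))
                   (punchIn j t))
    where x = sum (λ t → d t * a t)

  lincomb-injective : ∀ {k} {c d : Fin k → Carrier} (e : Fin k → Vect) → LinIndep e →
                      lincomb c e ≈ᵥ lincomb d e → ∀ j → c j ≈ d j
  lincomb-injective {c = c} {d} e e-indep ce≈de j = x-y≈0⇒x≈y _ _ (trans (+-congˡ (sym (-1*x≈-x _)))
    (e-indep (λ l → c l + - 1# * d l) (λ i → trans (lincomb-+ c _ e i)
      (trans (+-congˡ (lincomb-* (- 1#) d e i)) (trans (+-congˡ (-1*x≈-x _)) (x≈y⇒x-y≈0 (ce≈de i))))) j))
    where
    open import Algebra.Properties.AbelianGroup +-abelianGroup using ()
      renaming (x∙y⁻¹≈ε⇒x≈y to x-y≈0⇒x≈y; x≈y⇒x∙y⁻¹≈ε to x≈y⇒x-y≈0)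

  InSpan-tail : ∀ {k} {x : Vect} (e : Fin k → Vect) {w} (w∈xe : InSpan (x ∷ e) w) → proj₁ w∈xe zero ≈ 0# → InSpan e w
  InSpan-tail e (c , w≈cxe) c₀≈0 =
    c ∘ suc , λ i → trans (w≈cxe i) (trans (+-congʳ (trans (*-congʳ c₀≈0) (zeroˡ _))) (+-identityˡ _))

module OverField {F : CommutativeRing 0ℓ 0ℓ} (𝔽 : IsDiscreteField F) (n : ℕ) where
  open CommutativeRing F hiding (zero)
  open IsDiscreteField 𝔽
  open LinAlg F n
  open Vectors F n
  open IntegerCoefficients F using (solve; con; _:+_; _:*_; :-_; _:=_)

  IsZero? : ∀ u → Dec (IsZero u)
  IsZero? u = all? (λ i → u i ≟ 0#)

  InSpan-unscale : ∀ {k} (e : Fin k → Vect) {a u} → ¬ a ≈ 0# → InSpan e (a ·ᵥ u) → InSpan e u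
  InSpan-unscale e {a} {u} a≉0 au∈e = InSpan-resp e a⁻¹au≈u (InSpan-· e a⁻¹ au∈e)
    where
    a⁻¹ = proj₁ (inverse a a≉0)
    a⁻¹au≈u : (a⁻¹ ·ᵥ a ·ᵥ u) ≈ᵥ u
    a⁻¹au≈u i = trans (sym (*-assoc _ _ _)) (trans (*-congʳ (trans (*-comm _ _) (proj₂ (inverse a a≉0)))) (*-identityˡ _))

  head-coeff≈0 : ∀ {k l} {x w : Vect} (e : Fin k → Vect) (E : Fin l → Vect) → ¬ InSpan E x → (∀ j → InSpan E (e j)) →
                 (w∈xe : InSpan (x ∷ e) w) → InSpan E w → proj₁ w∈xe zero ≈ 0#
  head-coeff≈0 e E x∉E e⊆E (c , w≈cxe) w∈E with c zero ≟ 0#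
  ... | yes c₀≈0 = c₀≈0
  ... | no  c₀≉0 = ⊥-elim (x∉E (InSpan-unscale E c₀≉0
          (InSpan-cancelˡ E (InSpan-lincomb E (c ∘ suc) e e⊆E) (InSpan-resp E (λ i → trans (w≈cxe i) (+-comm _ _)) w∈E))))

  LinIndep-∷ : ∀ {k} {x : Vect} (w : Fin k → Vect) → LinIndep w → ¬ InSpan w x → LinIndep (x ∷ w)
  LinIndep-∷ w w-indep x∉w c cxw≈0 zero    = head-coeff≈0 w w x∉w (InSpan-member w) (c , λ i → refl) (InSpan-zero w cxw≈0)
  LinIndep-∷ w w-indep x∉w c cxw≈0 (suc j) = w-indep (c ∘ suc) tail≈0 j
    where
    c₀≈0 = LinIndep-∷ w w-indep x∉w c cxw≈0 zero
    tail≈0 : IsZero (lincomb (c ∘ suc) w)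
    tail≈0 i = trans (sym (trans (+-congʳ (trans (*-congʳ c₀≈0) (zeroˡ _))) (+-identityˡ _))) (cxw≈0 i)

  LinIndep-[_] : ∀ {x} → ¬ IsZero x → LinIndep (x ∷ [])
  LinIndep-[ x≉0 ] = LinIndep-∷ [] (λ _ _ ()) λ (_ , x≈0) → x≉0 x≈0

  steinitz : ∀ {k m} (e : Fin k → Vect) (w : Fin m → Vect) → k < m → LinIndep w → ¬ (∀ j → InSpan e (w j))
  steinitz {ℕ.zero} e w (ℕ.s≤s _) w-indep w⊆e =
    1≉0 (w-indep (δ zero) (λ i → trans (lincomb-δ zero w i) (proj₂ (w⊆e zero) i)) zero)
  steinitz {ℕ.suc k} {ℕ.suc m} e w (ℕ.s≤s k<m) w-indep w⊆e with all? (λ j → proj₁ (w⊆e j) zero ≟ 0#)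
  ... | yes heads≈0 = steinitz (e ∘ suc) w (ℕ.m<n⇒m<1+n k<m) w-indep λ j →
                        InSpan-tail (e ∘ suc) (w⊆e j) (heads≈0 j)
  ... | no ¬heads≈0 with ¬∀⟶∃¬ _ _ (λ j → proj₁ (w⊆e j) zero ≟ 0#) ¬heads≈0
  ...   | j₀ , γ≉0 = steinitz (e ∘ suc) _ k<m (LinIndep-shear {w = w} w-indep j₀ a) w′⊆e′
    where
    -- Eliminate the first vector of e from every other w t using w j₀, whose
    -- first coefficient γ is nonzero.
    c = λ j → proj₁ (w⊆e j)
    γ⁻¹ = proj₁ (inverse (c j₀ zero) γ≉0)
    a = λ t → - (c (punchIn j₀ t) zero * γ⁻¹)
    w′⊆e′ : ∀ t → InSpan (e ∘ suc) (removeAt w j₀ t +ᵥ a t ·ᵥ w j₀)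
    w′⊆e′ t = InSpan-tail (e ∘ suc) (InSpan-+ e (w⊆e (punchIn j₀ t)) (InSpan-· e (a t) (w⊆e j₀))) head-cancels
      where
      head-cancels : c (punchIn j₀ t) zero + a t * c j₀ zero ≈ 0#
      head-cancels = begin
        x + - (x * γ⁻¹) * γ  ≈⟨ solve 3 (λ x g γ → x :+ (:- (x :* g)) :* γ := x :+ :- (x :* (γ :* g))) refl x γ⁻¹ γ ⟩
        x + - (x * (γ * γ⁻¹)) ≈⟨ +-congˡ (-‿cong (trans (*-congˡ (proj₂ (inverse γ γ≉0))) (*-identityʳ x))) ⟩
        x + - x              ≈⟨ -‿inverseʳ x ⟩
        0#                   ∎
        where
        x = c (punchIn j₀ t) zero
        γ = c j₀ zero
        open import Relation.Binary.Reasoning.Setoid setoid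

  ¬¬-steinitz : ∀ {k m} (e : Fin k → Vect) (w : Fin m → Vect) → k < m → LinIndep w → ¬ (∀ j → ¬ ¬ InSpan e (w j))
  ¬¬-steinitz e w k<m w-indep w⊆e = ¬¬-∀-Fin w⊆e (steinitz e w k<m w-indep)

  LinIndep-∷⁻¹ : ∀ {k} {x : Vect} (w : Fin k → Vect) → LinIndep (x ∷ w) → ¬ InSpan w x
  LinIndep-∷⁻¹ {x = x} w xw-indep (c , x≈cw) = -1≉0 (xw-indep (- 1# ∷ c) relation zero)
    where
    open import Algebra.Properties.Ring ring using (-1*x≈-x; -0#≈0#; -‿involutive)
    -1≉0 : ¬ - 1# ≈ 0#
    -1≉0 -1≈0 = 1≉0 (trans (sym (-‿involutive 1#)) (trans (-‿cong -1≈0) -0#≈0#))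
    relation : IsZero (lincomb (- 1# ∷ c) (x ∷ w))
    relation i = trans (+-cong (-1*x≈-x _) (sym (x≈cw i))) (-‿inverseˡ _)

  exchange : ∀ {k} {x w : Vect} (e : Fin k → Vect) (w∈xe : InSpan (x ∷ e) w) → ¬ proj₁ w∈xe zero ≈ 0# → InSpan (w ∷ e) x
  exchange {w = w} e (c , w≈cxe) c₀≉0 = InSpan-unscale (w ∷ e) c₀≉0
    (InSpan-cancelˡ (w ∷ e) (InSpan-lincomb (w ∷ e) (c ∘ suc) e (InSpan-member (w ∷ e) ∘ suc))
                    (InSpan-resp (w ∷ e) (λ i → trans (w≈cxe i) (+-comm _ _)) (InSpan-member (w ∷ e) zero)))

  nonzero-multiple : ∀ {x w} → ¬ IsZero w → InSpan (x ∷ []) w → InSpan (w ∷ []) x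
  nonzero-multiple w≉0 w∈x with proj₁ w∈x zero ≟ 0#
  ... | yes a≈0 = ⊥-elim (w≉0 (proj₂ (InSpan-tail [] w∈x a≈0)))
  ... | no  a≉0 = exchange [] w∈x a≉0

  InSpan-swap : ∀ {x y w} → InSpan (x ∷ y ∷ []) w → InSpan (y ∷ x ∷ []) w
  InSpan-swap {x} {y} (c , w≈) = (c (suc zero) ∷ c zero ∷ []) , λ i → trans (w≈ i) (lincomb-swap (c zero) (c (suc zero)) x y i)

  LinIndep-swap : ∀ {x y} → LinIndep (x ∷ y ∷ []) → LinIndep (y ∷ x ∷ [])
  LinIndep-swap {x} {y} xy-indep c cyx≈0 = λ { zero → c′≈0 (suc zero) ; (suc zero) → c′≈0 zero }
    where
    c′≈0 = xy-indep (c (suc zero) ∷ c zero ∷ []) (λ i → trans (lincomb-swap _ _ x y i) (cyx≈0 i))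

  extend-to-spanning-pair : ∀ {x y w} → ¬ IsZero w → InSpan (x ∷ y ∷ []) w →
                            ∃[ z ] (InSpan (w ∷ z ∷ []) x × InSpan (w ∷ z ∷ []) y)
  extend-to-spanning-pair {x} {y} {w} w≉0 w∈xy@(c , w≈cxy) with c zero ≟ 0# | c (suc zero) ≟ 0#
  ... | no α≉0  | _       = y , exchange (y ∷ []) w∈xy α≉0 , InSpan-member (w ∷ y ∷ []) (suc zero)
  ... | yes _   | no β≉0  = x , InSpan-member (w ∷ x ∷ []) (suc zero) , exchange (x ∷ []) (InSpan-swap w∈xy) β≉0
  ... | yes α≈0 | yes β≈0 =
    ⊥-elim (w≉0 λ i → trans (w≈cxy i) (lincomb-0 {c = c} (x ∷ y ∷ []) (λ { zero → α≈0 ; (suc zero) → β≈0 }) i))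

  exchange-second : ∀ {a r z} → LinIndep (a ∷ r ∷ []) → InSpan (a ∷ z ∷ []) r → InSpan (a ∷ r ∷ []) z
  exchange-second {a} ar-indep r∈az with proj₁ (InSpan-swap r∈az) zero ≟ 0#
  ... | yes σ≈0 = ⊥-elim (LinIndep-∷⁻¹ (a ∷ []) (LinIndep-swap ar-indep) (InSpan-tail (a ∷ []) (InSpan-swap r∈az) σ≈0))
  ... | no  σ≉0 = InSpan-swap (exchange (a ∷ []) (InSpan-swap r∈az) σ≉0)

  independent-pair-spans-plane : ∀ {a r} (e : Fin 2 → Vect) → LinIndep (a ∷ r ∷ []) → InSpan e a → InSpan e r →
                                 ∀ j → InSpan (a ∷ r ∷ []) (e j)
  independent-pair-spans-plane {a} {r} e ar-indep a∈e r∈e j = InSpan-⊆ (a ∷ r ∷ []) (a ∷ z ∷ []) az⊆ar (e⊆az j)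
    where
    a≉0 : ¬ IsZero a
    a≉0 a≈0 = LinIndep-∷⁻¹ (r ∷ []) ar-indep (InSpan-zero (r ∷ []) a≈0)
    extension = extend-to-spanning-pair a≉0 a∈e
    z = proj₁ extension
    e⊆az : ∀ j → InSpan (a ∷ z ∷ []) (e j)
    e⊆az zero       = proj₁ (proj₂ extension)
    e⊆az (suc zero) = proj₂ (proj₂ extension)
    az⊆ar : ∀ j → InSpan (a ∷ r ∷ []) ((a ∷ z ∷ []) j)
    az⊆ar zero       = InSpan-member (a ∷ r ∷ []) zero
    az⊆ar (suc zero) = exchange-second ar-indep (InSpan-⊆ (a ∷ z ∷ []) e e⊆az r∈e)

  LinIndep-pair-pair : ∀ {u₀ u₁ v₀ v₁} → LinIndep (u₀ ∷ u₁ ∷ []) → LinIndep (v₀ ∷ v₁ ∷ []) →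
                       (∀ {w} → InSpan (u₀ ∷ u₁ ∷ []) w → InSpan (v₀ ∷ v₁ ∷ []) w → IsZero w) →
                       LinIndep (u₀ ∷ u₁ ∷ v₀ ∷ v₁ ∷ [])
  LinIndep-pair-pair {u₀} {u₁} {v₀} {v₁} u-indep v-indep meet c c·uv≈0 = coefficients≈0
    where
    open import Algebra.Properties.AbelianGroup +-abelianGroup using (inverseˡ-unique; inverseʳ-unique)
    open import Algebra.Properties.Ring ring using (-1*x≈-x; -0#≈0#)
    cᵤ = c zero ∷ c (suc zero) ∷ []
    cᵥ = c (suc (suc zero)) ∷ c (suc (suc (suc zero))) ∷ []
    s = lincomb cᵤ (u₀ ∷ u₁ ∷ [])
    t = lincomb cᵥ (v₀ ∷ v₁ ∷ [])
    s+t≈0 : ∀ i → s i + t i ≈ 0#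
    s+t≈0 i = trans (solve 3 (λ A B T → (A :+ (B :+ con (+ 0))) :+ T := A :+ (B :+ T)) refl _ _ (t i)) (c·uv≈0 i)
    s≈-1t : s ≈ᵥ (- 1# ·ᵥ t)
    s≈-1t i = trans (inverseˡ-unique _ _ (s+t≈0 i)) (sym (-1*x≈-x _))
    s≈0 : IsZero s
    s≈0 = meet (cᵤ , λ i → refl)
               (InSpan-resp (v₀ ∷ v₁ ∷ []) (λ i → sym (s≈-1t i)) (InSpan-· (v₀ ∷ v₁ ∷ []) (- 1#) (cᵥ , λ i → refl)))
    t≈0 : IsZero t
    t≈0 i = trans (inverseʳ-unique _ _ (s+t≈0 i)) (trans (-‿cong (s≈0 i)) -0#≈0#)
    coefficients≈0 : ∀ j → c j ≈ 0#
    coefficients≈0 zero                      = u-indep cᵤ s≈0 zero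
    coefficients≈0 (suc zero)                = u-indep cᵤ s≈0 (suc zero)
    coefficients≈0 (suc (suc zero))          = v-indep cᵥ t≈0 zero
    coefficients≈0 (suc (suc (suc zero)))    = v-indep cᵥ t≈0 (suc zero)

-- The graph Γ₂ of planes

module Planes {F : CommutativeRing 0ℓ 0ℓ} (𝔽 : IsDiscreteField F) (n : ℕ) where
  open CommutativeRing F hiding (zero)
  open LinAlg F n
  open Vectors F n
  open OverField 𝔽 n

  MeetTrivially : Sub2 → Sub2 → Set
  MeetTrivially X Y = ∀ {w} → w ∈₂ X → w ∈₂ Y → IsZero w

  non-adjacent-planes-meet-trivially : ∀ X Y → ¬ X ≈₂ Y → ¬ Adj₂ X Y → MeetTrivially X Y
  non-adjacent-planes-meet-trivially X Y X≉Y X≁Y w∈X w∈Y =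
    decidable-stable (IsZero? _) λ w≉0 → X≁Y (X≉Y , _ , w≉0 , w∈X , w∈Y)

  Adj₂-respects : AdjRespects≈ Γ₂
  Adj₂-respects X X′ Y Y′ X≈X′ Y≈Y′ (X≉Y , w , w≉0 , w∈X , w∈Y) =
    (λ X′≈Y′ → X≉Y (≈-trans {X} {X′} {Y} X≈X′ (≈-trans {X′} {Y′} {Y} X′≈Y′ (≈-sym {Y} {Y′} Y≈Y′))))
    , w , w≉0 , proj₁ X≈X′ w w∈X , proj₁ Y≈Y′ w w∈Y
    where open Setoid Sub2-setoid using () renaming (trans to ≈-trans; sym to ≈-sym)

  Cset-respects : ∀ {k} (b : Fin k → Vect) p p′ X Y → X ≈₂ Y → Cset b p p′ X → Cset b p p′ Y
  Cset-respects b p p′ X Y (X⊆Y , Y⊆X) (X⊆b , p∈X , p′∉X) = (λ w → X⊆b w ∘ Y⊆X w) , X⊆Y p p∈X , p′∉X ∘ Y⊆X p′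

  switched-Γ₂-respects : ∀ {k} (b : Fin k → Vect) p₁ p₂ → AdjRespects≈ (switch Γ₂ (Cset b p₁ p₂) (Cset b p₂ p₁))
  switched-Γ₂-respects b p₁ p₂ =
    switch-respects Γ₂ Adj₂-respects (Cset b p₁ p₂) (Cset b p₂ p₁) (Cset-respects b p₁ p₂) (Cset-respects b p₂ p₁)

  Adj₂-sym : ∀ X Y → Adj₂ X Y → Adj₂ Y X
  Adj₂-sym X Y (X≉Y , w , w≉0 , w∈X , w∈Y) = (λ (Y⊆X , X⊆Y) → X≉Y (X⊆Y , Y⊆X)) , w , w≉0 , w∈Y , w∈X

  ≁-by-meet : ∀ X Y → MeetTrivially X Y → ¬ Adj₂ X Y
  ≁-by-meet X Y X⊓Y≈0 (_ , w , w≉0 , w∈X , w∈Y) = w≉0 (X⊓Y≈0 w∈X w∈Y)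

  ≈₂-by-common-pair : ∀ {a r} (X Y : Sub2) → LinIndep (a ∷ r ∷ []) →
                      a ∈₂ X → r ∈₂ X → a ∈₂ Y → r ∈₂ Y → X ≈₂ Y
  ≈₂-by-common-pair {a} {r} X Y ar-indep a∈X r∈X a∈Y r∈Y = X⊆Y , Y⊆X
    where
    via-pair : ∀ (P Q : Sub2) → a ∈₂ P → r ∈₂ P → a ∈₂ Q → r ∈₂ Q → ∀ w → w ∈₂ P → w ∈₂ Q
    via-pair P Q a∈P r∈P a∈Q r∈Q w w∈P =
      InSpan-⊆ (Sub2.basis Q) (a ∷ r ∷ []) (λ { zero → a∈Q ; (suc zero) → r∈Q })
        (InSpan-⊆ (a ∷ r ∷ []) (Sub2.basis P) (independent-pair-spans-plane (Sub2.basis P) ar-indep a∈P r∈P) w∈P)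
    X⊆Y = via-pair X Y a∈X r∈X a∈Y r∈Y
    Y⊆X = via-pair Y X a∈Y r∈Y a∈X r∈X

  meeting-planes-span-≤3 : ∀ {r} (X Y : Sub2) → ¬ IsZero r → r ∈₂ X → r ∈₂ Y →
                           ∃[ π ] (X ⊆span π × Y ⊆span π)
  meeting-planes-span-≤3 {r} X Y r≉0 r∈X r∈Y = π , X⊆π , Y⊆π
    where
    extension = extend-to-spanning-pair r≉0 r∈Y
    z = proj₁ extension
    π = Sub2.basis X zero ∷ Sub2.basis X (suc zero) ∷ z ∷ []
    X⊆π : X ⊆span π
    X⊆π w = InSpan-⊆ π (Sub2.basis X) (λ { zero → InSpan-member π zero ; (suc zero) → InSpan-member π (suc zero) })
    rz⊆π : ∀ j → InSpan π ((r ∷ z ∷ []) j)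
    rz⊆π zero       = X⊆π r r∈X
    rz⊆π (suc zero) = InSpan-member π (suc (suc zero))
    Y⊆π : Y ⊆span π
    Y⊆π w = InSpan-⊆ π (r ∷ z ∷ []) rz⊆π ∘ InSpan-⊆ (r ∷ z ∷ []) (Sub2.basis Y)
              (λ { zero → proj₁ (proj₂ extension) ; (suc zero) → proj₂ (proj₂ extension) })

  plane-meeting-both-⊆span : ∀ {r k} (π : Fin k → Vect) (X Y T : Sub2) → ¬ X ≈₂ Y → ¬ IsZero r → r ∈₂ X → r ∈₂ Y →
                             ¬ r ∈₂ T → Adj₂ T X → Adj₂ T Y → X ⊆span π → Y ⊆span π → T ⊆span π
  plane-meeting-both-⊆span {r} π X Y T X≉Y r≉0 r∈X r∈Y r∉T
                           (_ , a , a≉0 , a∈T , a∈X) (_ , b , b≉0 , b∈T , b∈Y) X⊆π Y⊆π w w∈T =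
    InSpan-⊆ π (b ∷ a ∷ []) (λ { zero → Y⊆π b b∈Y ; (suc zero) → X⊆π a a∈X })
      (InSpan-⊆ (b ∷ a ∷ []) (Sub2.basis T) (independent-pair-spans-plane (Sub2.basis T) ba-indep b∈T a∈T) w∈T)
    where
    rb-indep : LinIndep (r ∷ b ∷ [])
    rb-indep = LinIndep-∷ (b ∷ []) LinIndep-[ b≉0 ] (r∉T ∘ InSpan-⊆ (Sub2.basis T) (b ∷ []) (λ { zero → b∈T }))
    b∉X : ¬ b ∈₂ X
    b∉X b∈X = X≉Y (≈₂-by-common-pair X Y rb-indep r∈X b∈X r∈Y b∈Y)
    ba-indep : LinIndep (b ∷ a ∷ [])
    ba-indep = LinIndep-∷ (a ∷ []) LinIndep-[ a≉0 ] (b∉X ∘ InSpan-⊆ (Sub2.basis X) (a ∷ []) (λ { zero → a∈X }))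

  planes-in-3-space-meet : ∀ (T T′ : Sub2) (π : Fin 3 → Vect) → T ⊆span π → T′ ⊆span π → ¬ MeetTrivially T T′
  planes-in-3-space-meet T T′ π T⊆π T′⊆π T⊓T′≈0 =
    steinitz π bases ℕ.≤-refl (LinIndep-pair-pair (Sub2.indep T) (Sub2.indep T′) T⊓T′≈0) bases⊆π
    where
    bases = Sub2.basis T zero ∷ Sub2.basis T (suc zero) ∷ Sub2.basis T′ zero ∷ Sub2.basis T′ (suc zero) ∷ []
    bases⊆π : ∀ j → InSpan π (bases j)
    bases⊆π zero                   = T⊆π _ (InSpan-member (Sub2.basis T) zero)
    bases⊆π (suc zero)             = T⊆π _ (InSpan-member (Sub2.basis T) (suc zero))
    bases⊆π (suc (suc zero))       = T′⊆π _ (InSpan-member (Sub2.basis T′) zero)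
    bases⊆π (suc (suc (suc zero))) = T′⊆π _ (InSpan-member (Sub2.basis T′) (suc zero))

  Γ₂-has-no-induced-K113 : ¬ InducedK113 Γ₂
  Γ₂-has-no-induced-K113 K with InducedK113.x~y K
  ... | x≉y , r , r≉0 , r∈x , r∈y with meeting-planes-span-≤3 (InducedK113.x K) (InducedK113.y K) r≉0 r∈x r∈y
  ...   | π , x⊆π , y⊆π =
    two-of-three-fail (λ i → r ∈₂ z i) (λ i≢j r∈zi r∈zj → z≁z i≢j (z≉z i≢j , r , r≉0 , r∈zi , r∈zj))
      λ (i , j , i≢j , r∉zi , r∉zj) → planes-in-3-space-meet (z i) (z j) π (z⊆π i r∉zi) (z⊆π j r∉zj)
                                        (non-adjacent-planes-meet-trivially (z i) (z j) (z≉z i≢j) (z≁z i≢j))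
    where
    open InducedK113 K
    z⊆π : ∀ i → ¬ r ∈₂ z i → z i ⊆span π
    z⊆π i r∉zi = plane-meeting-both-⊆span π x y (z i) x≉y r≉0 r∈x r∈y r∉zi (z~x i) (z~y i) x⊆π y⊆π

-- An induced K₁,₁,₃ in the switched graph

pattern v̂  = zero
pattern û  = suc zero
pattern p̂₂ = suc (suc zero)
pattern p̂₁ = suc (suc (suc zero))

module _ {F : CommutativeRing 0ℓ 0ℓ} (𝔽 : IsDiscreteField F) (n : ℕ) where
  open LinAlg F n

  module SwitchedConfiguration {s} (b : Fin s → Vect) {p₁ p₂ u v : Vect}
    (p₁∈S : InSpan b p₁) (p₂∈S : InSpan b p₂) (u∈S : InSpan b u) (v∉S : ¬ InSpan b v)
    (p₁≉0 : ¬ IsZero p₁) (p₂∉⟨p₁⟩ : ¬ InSpan (p₁ ∷ []) p₂) (u∉⟨p₂,p₁⟩ : ¬ InSpan (p₂ ∷ p₁ ∷ []) u) where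

    open CommutativeRing F hiding (zero)
    open IsDiscreteField 𝔽
    open Vectors F n
    open OverField 𝔽 n
    open Planes 𝔽 n

    β : Fin 4 → Vect
    β = v ∷ u ∷ p₂ ∷ p₁ ∷ []

    β⁻⊆S : ∀ j → InSpan b ((u ∷ p₂ ∷ p₁ ∷ []) j)
    β⁻⊆S zero             = u∈S
    β⁻⊆S (suc zero)       = p₂∈S
    β⁻⊆S (suc (suc zero)) = p₁∈S

    β-indep : LinIndep β
    β-indep = LinIndep-∷ (u ∷ p₂ ∷ p₁ ∷ [])
                (LinIndep-∷ (p₂ ∷ p₁ ∷ []) (LinIndep-∷ (p₁ ∷ []) LinIndep-[ p₁≉0 ] p₂∉⟨p₁⟩) u∉⟨p₂,p₁⟩)
                (v∉S ∘ InSpan-⊆ b (u ∷ p₂ ∷ p₁ ∷ []) β⁻⊆S)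

    -- Vectors are described by their coordinates with respect to β, which for
    -- the vertices below are 0 or 1.
    Pattern : Set
    Pattern = Fin 4 → Bool

    bit : Bool → Carrier
    bit false = 0#
    bit true  = 1#

    ⟦_⟧ : Pattern → Vect
    ⟦ A ⟧ = lincomb (bit ∘ A) β

    comb : Carrier → Carrier → Bool → Bool → Carrier
    comb a c false false = 0#
    comb a c true  false = a
    comb a c false true  = c
    comb a c true  true  = a + c

    comb-correct : ∀ a c x y → a * bit x + c * bit y ≈ comb a c x y
    comb-correct a c false false = trans (+-cong (zeroʳ a) (zeroʳ c)) (+-identityʳ 0#)
    comb-correct a c true  false = trans (+-cong (*-identityʳ a) (zeroʳ c)) (+-identityʳ a)
    comb-correct a c false true  = trans (+-cong (zeroʳ a) (*-identityʳ c)) (+-identityˡ c)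
    comb-correct a c true  true  = +-cong (*-identityʳ a) (*-identityʳ c)

    lincomb-⟦⟧ : ∀ (A B : Pattern) a c →
                 lincomb (a ∷ c ∷ []) (⟦ A ⟧ ∷ ⟦ B ⟧ ∷ []) ≈ᵥ lincomb (λ j → comb a c (A j) (B j)) β
    lincomb-⟦⟧ A B a c i = begin
      a * ⟦ A ⟧ i + (c * ⟦ B ⟧ i + 0#)
        ≈⟨ +-congˡ (+-identityʳ _) ⟩
      a * ⟦ A ⟧ i + c * ⟦ B ⟧ i
        ≈⟨ +-cong (sym (lincomb-* a (bit ∘ A) β i)) (sym (lincomb-* c (bit ∘ B) β i)) ⟩
      lincomb (λ j → a * bit (A j)) β i + lincomb (λ j → c * bit (B j)) β i
        ≈⟨ sym (lincomb-+ (λ j → a * bit (A j)) (λ j → c * bit (B j)) β i) ⟩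
      lincomb (λ j → a * bit (A j) + c * bit (B j)) β i
        ≈⟨ lincomb-cong β (λ j → comb-correct a c (A j) (B j)) i ⟩
      lincomb (λ j → comb a c (A j) (B j)) β i
        ∎
      where open import Relation.Binary.Reasoning.Setoid setoid

    first≈0 : ∀ {a c} x y → T (x ∧ not y) → comb a c x y ≈ 0# → a ≈ 0#
    first≈0 true false _ a≈0 = a≈0

    second≈0 : ∀ {a c} x y → T (y ∧ not x) → comb a c x y ≈ 0# → c ≈ 0#
    second≈0 false true _ c≈0 = c≈0

    -- Coordinates i and j witness the independence of ⟦ A ⟧ and ⟦ B ⟧.
    plane : (A B : Pattern) (i j : Fin 4) → {T (A i ∧ not (B i))} → {T (B j ∧ not (A j))} → Sub2
    plane A B i j {i-sep} {j-sep} = sub2 (⟦ A ⟧ ∷ ⟦ B ⟧ ∷ []) indep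
      where
      coords≈0 : ∀ k → IsZero (lincomb k (⟦ A ⟧ ∷ ⟦ B ⟧ ∷ [])) → ∀ l → comb (k zero) (k (suc zero)) (A l) (B l) ≈ 0#
      coords≈0 k k·AB≈0 = lincomb-injective β β-indep λ i → trans (sym (lincomb-⟦⟧ A B (k zero) (k (suc zero)) i))
                                                                (trans (k·AB≈0 i) (sym (lincomb-0 β (λ _ → refl) i)))
      indep : LinIndep (⟦ A ⟧ ∷ ⟦ B ⟧ ∷ [])
      indep k k·AB≈0 zero       = first≈0 (A i) (B i) i-sep (coords≈0 k k·AB≈0 i)
      indep k k·AB≈0 (suc zero) = second≈0 (A j) (B j) j-sep (coords≈0 k k·AB≈0 j)

    bit-true≉0 : ∀ x → T x → ¬ bit x ≈ 0#
    bit-true≉0 true _ = 1≉0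

    bit-false≈0 : ∀ x → T (not x) → bit x ≈ 0#
    bit-false≈0 false _ = refl

    ⟦⟧∈β : ∀ A → InSpan β ⟦ A ⟧
    ⟦⟧∈β A = bit ∘ A , λ i → refl

    ⟦⟧∈S : ∀ A → {T (not (A v̂))} → InSpan b ⟦ A ⟧
    ⟦⟧∈S A {v̂∉A} =
      InSpan-⊆ b (u ∷ p₂ ∷ p₁ ∷ []) β⁻⊆S (InSpan-tail (u ∷ p₂ ∷ p₁ ∷ []) (⟦⟧∈β A) (bit-false≈0 (A v̂) v̂∉A))

    ⟦⟧∉S : ∀ A → {T (A v̂)} → ¬ InSpan b ⟦ A ⟧
    ⟦⟧∉S A {v̂∈A} A∈S = bit-true≉0 (A v̂) v̂∈A (head-coeff≈0 (u ∷ p₂ ∷ p₁ ∷ []) b v∉S β⁻⊆S (⟦⟧∈β A) A∈S)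

    ⟦⟧≉0 : ∀ A i → {T (A i)} → ¬ IsZero ⟦ A ⟧
    ⟦⟧≉0 A i {i∈A} A≈0 = bit-true≉0 (A i) i∈A
      (lincomb-injective {c = bit ∘ A} β β-indep (λ l → trans (A≈0 l) (sym (lincomb-0 β (λ _ → refl) l))) i)

    pair-coords : ∀ A B {w} → InSpan (⟦ A ⟧ ∷ ⟦ B ⟧ ∷ []) w →
                  ∃[ a ] ∃[ c ] (w ≈ᵥ lincomb (λ l → comb a c (A l) (B l)) β)
    pair-coords A B (k , w≈kAB) = k zero , k (suc zero) , λ i → trans (w≈kAB i) (lincomb-⟦⟧ A B (k zero) (k (suc zero)) i)

    pair-coords⁻¹ : ∀ A B C a c → (∀ l → bit (C l) ≈ comb a c (A l) (B l)) → InSpan (⟦ A ⟧ ∷ ⟦ B ⟧ ∷ []) ⟦ C ⟧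
    pair-coords⁻¹ A B C a c C≈ = (a ∷ c ∷ []) , λ i → trans (lincomb-cong β C≈ i) (sym (lincomb-⟦⟧ A B a c i))

    ∉-by-coords : ∀ A B C → (∀ a c → (∀ l → bit (C l) ≈ comb a c (A l) (B l)) → ⊥) →
                  ¬ InSpan (⟦ A ⟧ ∷ ⟦ B ⟧ ∷ []) ⟦ C ⟧
    ∉-by-coords A B C no-coords C∈AB with pair-coords A B C∈AB
    ... | a , c , C≈ = no-coords a c (lincomb-injective β β-indep C≈)

    meet-trivially-by-coords : ∀ A B A′ B′ →
      (∀ a c a′ c′ → (∀ l → comb a c (A l) (B l) ≈ comb a′ c′ (A′ l) (B′ l)) → ∀ l → comb a c (A l) (B l) ≈ 0#) →
      ∀ {w} → InSpan (⟦ A ⟧ ∷ ⟦ B ⟧ ∷ []) w → InSpan (⟦ A′ ⟧ ∷ ⟦ B′ ⟧ ∷ []) w → IsZero w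
    meet-trivially-by-coords A B A′ B′ coords≈0 w∈AB w∈A′B′ with pair-coords A B w∈AB | pair-coords A′ B′ w∈A′B′
    ... | a , c , w≈ | a′ , c′ , w≈′ =
      λ i → trans (w≈ i) (lincomb-0 β (coords≈0 a c a′ c′ (lincomb-injective β β-indep (λ i → trans (sym (w≈ i)) (w≈′ i)))) i)

    V U P₂ P₁ V+P₁ U+P₂ : Pattern
    V    = true  ∷ false ∷ false ∷ false ∷ []
    U    = false ∷ true  ∷ false ∷ false ∷ []
    P₂   = false ∷ false ∷ true  ∷ false ∷ []
    P₁   = false ∷ false ∷ false ∷ true  ∷ []
    V+P₁ = true  ∷ false ∷ false ∷ true  ∷ []
    U+P₂ = false ∷ true  ∷ true  ∷ false ∷ []

    X C L Z₁ Z₂ A₁ A₂ : Sub2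
    X  = plane P₁   V    p̂₁ v̂
    C  = plane P₂   U    p̂₂ û
    L  = plane P₁   P₂   p̂₁ p̂₂
    Z₁ = plane V    U    v̂  û
    Z₂ = plane V+P₁ U+P₂ v̂  û
    A₁ = plane P₁   U    p̂₁ û
    A₂ = plane P₁   U+P₂ p̂₁ û

    ⟦P₁⟧≈p₁ : ⟦ P₁ ⟧ ≈ᵥ p₁
    ⟦P₁⟧≈p₁ i = trans (lincomb-cong {c = bit ∘ P₁} {d = δ p̂₁} β (λ { v̂ → refl ; û → refl ; p̂₂ → refl ; p̂₁ → refl }) i)
                      (lincomb-δ p̂₁ β i)

    ⟦P₂⟧≈p₂ : ⟦ P₂ ⟧ ≈ᵥ p₂
    ⟦P₂⟧≈p₂ i = trans (lincomb-cong {c = bit ∘ P₂} {d = δ p̂₂} β (λ { v̂ → refl ; û → refl ; p̂₂ → refl ; p̂₁ → refl }) i)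
                      (lincomb-δ p̂₂ β i)

    p₁∈ : ∀ (Y : Sub2) → ⟦ P₁ ⟧ ∈₂ Y → p₁ ∈₂ Y
    p₁∈ Y = InSpan-resp (Sub2.basis Y) ⟦P₁⟧≈p₁

    p₂∈ : ∀ (Y : Sub2) → ⟦ P₂ ⟧ ∈₂ Y → p₂ ∈₂ Y
    p₂∈ Y = InSpan-resp (Sub2.basis Y) ⟦P₂⟧≈p₂

    ⟦P₁⟧∈ : ∀ (Y : Sub2) → p₁ ∈₂ Y → ⟦ P₁ ⟧ ∈₂ Y
    ⟦P₁⟧∈ Y = InSpan-resp (Sub2.basis Y) (sym ∘ ⟦P₁⟧≈p₁)

    ⟦P₂⟧∈ : ∀ (Y : Sub2) → p₂ ∈₂ Y → ⟦ P₂ ⟧ ∈₂ Y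
    ⟦P₂⟧∈ Y = InSpan-resp (Sub2.basis Y) (sym ∘ ⟦P₂⟧≈p₂)

    first∈ : ∀ (Y : Sub2) → Sub2.basis Y zero ∈₂ Y
    first∈ Y = InSpan-member (Sub2.basis Y) zero

    second∈ : ∀ (Y : Sub2) → Sub2.basis Y (suc zero) ∈₂ Y
    second∈ Y = InSpan-member (Sub2.basis Y) (suc zero)

    plane⊆S : ∀ A B i j {i-sep j-sep} → {T (not (A v̂))} → {T (not (B v̂))} → plane A B i j {i-sep} {j-sep} ⊆span b
    plane⊆S A B i j {_} {_} {v̂∉A} {v̂∉B} w =
      InSpan-⊆ b (⟦ A ⟧ ∷ ⟦ B ⟧ ∷ []) λ { zero → ⟦⟧∈S A {v̂∉A} ; (suc zero) → ⟦⟧∈S B {v̂∉B} }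

    ≉-by-member : ∀ {w} (Y Y′ : Sub2) → w ∈₂ Y → ¬ w ∈₂ Y′ → ¬ Y ≈₂ Y′
    ≉-by-member Y Y′ w∈Y w∉Y′ (Y⊆Y′ , _) = w∉Y′ (Y⊆Y′ _ w∈Y)

    ≉-by-S : ∀ {w} (Y Y′ : Sub2) → w ∈₂ Y → ¬ InSpan b w → Y′ ⊆span b → ¬ Y ≈₂ Y′
    ≉-by-S Y Y′ w∈Y w∉S Y′⊆S = ≉-by-member Y Y′ w∈Y (w∉S ∘ Y′⊆S _)

    ≉-sym : ∀ (Y Y′ : Sub2) → ¬ Y ≈₂ Y′ → ¬ Y′ ≈₂ Y
    ≉-sym Y Y′ Y≉Y′ (Y′⊆Y , Y⊆Y′) = Y≉Y′ (Y⊆Y′ , Y′⊆Y)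

    p₁∉C : ¬ p₁ ∈₂ C
    p₁∉C = ∉-by-coords P₂ U P₁ (λ a c eq → 1≉0 (eq p̂₁)) ∘ ⟦P₁⟧∈ C

    p₂∉A₁ : ¬ p₂ ∈₂ A₁
    p₂∉A₁ = ∉-by-coords P₁ U P₂ (λ a c eq → 1≉0 (eq p̂₂)) ∘ ⟦P₂⟧∈ A₁

    p₂∉A₂ : ¬ p₂ ∈₂ A₂
    p₂∉A₂ = ∉-by-coords P₁ U+P₂ P₂ (λ a c eq → 1≉0 (trans (eq p̂₂) (sym (eq û)))) ∘ ⟦P₂⟧∈ A₂

    p₁∉Z₁ : ¬ p₁ ∈₂ Z₁
    p₁∉Z₁ = ∉-by-coords V U P₁ (λ a c eq → 1≉0 (eq p̂₁)) ∘ ⟦P₁⟧∈ Z₁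

    p₁∉Z₂ : ¬ p₁ ∈₂ Z₂
    p₁∉Z₂ = ∉-by-coords V+P₁ U+P₂ P₁ (λ a c eq → 1≉0 (trans (eq p̂₁) (sym (eq v̂)))) ∘ ⟦P₁⟧∈ Z₂

    v+p₁∉Z₁ : ¬ ⟦ V+P₁ ⟧ ∈₂ Z₁
    v+p₁∉Z₁ = ∉-by-coords V U V+P₁ (λ a c eq → 1≉0 (eq p̂₁))

    L⊓Z₁≈0 : MeetTrivially L Z₁
    L⊓Z₁≈0 = meet-trivially-by-coords P₁ P₂ V U λ a c a′ c′ eq →
      λ { v̂ → refl ; û → refl ; p̂₂ → eq p̂₂ ; p̂₁ → eq p̂₁ }

    L⊓Z₂≈0 : MeetTrivially L Z₂
    L⊓Z₂≈0 = meet-trivially-by-coords P₁ P₂ V+P₁ U+P₂ λ a c a′ c′ eq →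
      λ { v̂ → refl ; û → refl ; p̂₂ → trans (eq p̂₂) (sym (eq û)) ; p̂₁ → trans (eq p̂₁) (sym (eq v̂)) }

    Z₁⊓Z₂≈0 : MeetTrivially Z₁ Z₂
    Z₁⊓Z₂≈0 = meet-trivially-by-coords V U V+P₁ U+P₂ λ a c a′ c′ eq →
      λ { v̂ → trans (eq v̂) (sym (eq p̂₁)) ; û → trans (eq û) (sym (eq p̂₂)) ; p̂₂ → refl ; p̂₁ → refl }

    C₁ C₂ : Sub2 → Set
    C₁ = Cset b p₁ p₂
    C₂ = Cset b p₂ p₁

    open Switch Γ₂ C₁ C₂

    C∈C₂ : C₂ C
    C∈C₂ = plane⊆S P₂ U p̂₂ û , p₂∈ C (first∈ C) , p₁∉C

    A₁∈C₁ : C₁ A₁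
    A₁∈C₁ = plane⊆S P₁ U p̂₁ û , p₁∈ A₁ (first∈ A₁) , p₂∉A₁

    A₂∈C₁ : C₁ A₂
    A₂∈C₁ = plane⊆S P₁ U+P₂ p̂₁ û , p₁∈ A₂ (first∈ A₂) , p₂∉A₂

    InD-by-S : ∀ {w} (Y : Sub2) → w ∈₂ Y → ¬ InSpan b w → InD Y
    InD-by-S Y w∈Y w∉S (inj₁ (Y⊆S , _)) = w∉S (Y⊆S _ w∈Y)
    InD-by-S Y w∈Y w∉S (inj₂ (Y⊆S , _)) = w∉S (Y⊆S _ w∈Y)

    L∈D : InD L
    L∈D (inj₁ (_ , _ , p₂∉L)) = p₂∉L (p₂∈ L (second∈ L))
    L∈D (inj₂ (_ , _ , p₁∉L)) = p₁∉L (p₁∈ L (first∈ L))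

    X∈D : InD X
    X∈D = InD-by-S X (second∈ X) (⟦⟧∉S V)

    X∩S⊆⟨p₁⟩ : ∀ {w} → ¬ IsZero w → w ∈₂ X → InSpan b w → InSpan (w ∷ []) ⟦ P₁ ⟧
    X∩S⊆⟨p₁⟩ w≉0 w∈X w∈S = nonzero-multiple w≉0 (InSpan-tail (⟦ P₁ ⟧ ∷ []) (InSpan-swap w∈X)
      (head-coeff≈0 (⟦ P₁ ⟧ ∷ []) b (⟦⟧∉S V) (λ { zero → ⟦⟧∈S P₁ }) (InSpan-swap w∈X) w∈S))

    X-neighbourhood-in-C : NbC≐ X C₁
    X-neighbourhood-in-C Y Y∈C = mk⇔ (to Y∈C) from
      where
      to : InC Y → Adj₂ X Y → C₁ Y
      to (inj₁ Y∈C₁) _ = Y∈C₁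
      to (inj₂ (Y⊆S , _ , p₁∉Y)) (_ , w , w≉0 , w∈X , w∈Y) =
        ⊥-elim (p₁∉Y (p₁∈ Y (InSpan-⊆ (Sub2.basis Y) (w ∷ []) (λ { zero → w∈Y })
                                     (X∩S⊆⟨p₁⟩ w≉0 w∈X (Y⊆S w w∈Y)))))
      from : C₁ Y → Adj₂ X Y
      from (Y⊆S , p₁∈Y , _) = ≉-by-S X Y (second∈ X) (⟦⟧∉S V) Y⊆S , p₁ , p₁≉0 , p₁∈ X (first∈ X) , p₁∈Y

    adjacent-via : ∀ (Y Y′ : Sub2) A i → {T (A i)} → ¬ Y ≈₂ Y′ → ⟦ A ⟧ ∈₂ Y → ⟦ A ⟧ ∈₂ Y′ → Adj₂ Y Y′
    adjacent-via Y Y′ A i {i∈A} Y≉Y′ A∈Y A∈Y′ = Y≉Y′ , ⟦ A ⟧ , ⟦⟧≉0 A i {i∈A} , A∈Y , A∈Y′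

    Cross-via-C₁ : ∀ Y A → C₁ A → Adj₂ Y A → Adj₂ Y C → Cross Y C
    Cross-via-C₁ Y A A∈C₁ Y~A Y~C = inj₂ (inj₂ (¬NbC₂ , ¬NbC₁ , Y~C))
      where
      ¬NbC₂ : ¬ NbC≐ Y C₂
      ¬NbC₂ nb = proj₂ (proj₂ (Equivalence.to (nb A (inj₁ A∈C₁)) Y~A)) (proj₁ (proj₂ A∈C₁))
      ¬NbC₁ : ¬ NbC≐ Y C₁
      ¬NbC₁ nb = p₁∉C (proj₁ (proj₂ (Equivalence.to (nb C (inj₂ C∈C₂)) Y~C)))

    zs : Fin 3 → Sub2
    zs = L ∷ Z₁ ∷ Z₂ ∷ []

    zs∈D : ∀ i → InD (zs i)
    zs∈D zero             = L∈D
    zs∈D (suc zero)       = InD-by-S Z₁ (first∈ Z₁) (⟦⟧∉S V)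
    zs∈D (suc (suc zero)) = InD-by-S Z₂ (first∈ Z₂) (⟦⟧∉S V+P₁)

    v+p₁∈X : ⟦ V+P₁ ⟧ ∈₂ X
    v+p₁∈X = pair-coords⁻¹ P₁ V V+P₁ 1# 1# λ { v̂ → refl ; û → refl ; p̂₂ → refl ; p̂₁ → refl }

    u+p₂∈C : ⟦ U+P₂ ⟧ ∈₂ C
    u+p₂∈C = pair-coords⁻¹ P₂ U U+P₂ 1# 1# λ { v̂ → refl ; û → refl ; p̂₂ → refl ; p̂₁ → refl }

    L⊆S : L ⊆span b
    L⊆S = plane⊆S P₁ P₂ p̂₁ p̂₂

    p₁∈X : p₁ ∈₂ X
    p₁∈X = p₁∈ X (first∈ X)

    zs~X : ∀ i → Adj₂ (zs i) X
    zs~X zero             = adjacent-via L X P₁ p̂₁ (≉-sym X L (≉-by-S X L (second∈ X) (⟦⟧∉S V) L⊆S)) (first∈ L) (first∈ X)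
    zs~X (suc zero)       = adjacent-via Z₁ X V v̂ (≉-sym X Z₁ (≉-by-member X Z₁ p₁∈X p₁∉Z₁)) (first∈ Z₁) (second∈ X)
    zs~X (suc (suc zero)) = adjacent-via Z₂ X V+P₁ v̂ (≉-sym X Z₂ (≉-by-member X Z₂ p₁∈X p₁∉Z₂)) (first∈ Z₂) v+p₁∈X

    zs~C : ∀ i → Adj₂ (zs i) C
    zs~C zero             = adjacent-via L C P₂ p̂₂ (≉-by-member L C (p₁∈ L (first∈ L)) p₁∉C) (second∈ L) (first∈ C)
    zs~C (suc zero)       = adjacent-via Z₁ C U û (≉-by-S Z₁ C (first∈ Z₁) (⟦⟧∉S V) (proj₁ C∈C₂)) (second∈ Z₁) (second∈ C)
    zs~C (suc (suc zero)) = adjacent-via Z₂ C U+P₂ û (≉-by-S Z₂ C (first∈ Z₂) (⟦⟧∉S V+P₁) (proj₁ C∈C₂)) (second∈ Z₂) u+p₂∈C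

    L~A₁ : Adj₂ L A₁
    L~A₁ = adjacent-via L A₁ P₁ p̂₁ (≉-by-member L A₁ (p₂∈ L (second∈ L)) p₂∉A₁) (first∈ L) (first∈ A₁)

    Z₁~A₁ : Adj₂ Z₁ A₁
    Z₁~A₁ = adjacent-via Z₁ A₁ U û (≉-by-S Z₁ A₁ (first∈ Z₁) (⟦⟧∉S V) (proj₁ A₁∈C₁)) (second∈ Z₁) (second∈ A₁)

    Z₂~A₂ : Adj₂ Z₂ A₂
    Z₂~A₂ = adjacent-via Z₂ A₂ U+P₂ û (≉-by-S Z₂ A₂ (first∈ Z₂) (⟦⟧∉S V+P₁) (proj₁ A₂∈C₁)) (second∈ Z₂) (second∈ A₂)

    zs-cross : ∀ i → Cross (zs i) C
    zs-cross zero             = Cross-via-C₁ L  A₁ A₁∈C₁ L~A₁  (zs~C zero)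
    zs-cross (suc zero)       = Cross-via-C₁ Z₁ A₁ A₁∈C₁ Z₁~A₁ (zs~C (suc zero))
    zs-cross (suc (suc zero)) = Cross-via-C₁ Z₂ A₂ A₂∈C₁ Z₂~A₂ (zs~C (suc (suc zero)))

    zs≁zs : ∀ {i j} → i ≢ j → ¬ Adj₂ (zs i) (zs j)
    zs≁zs = pairwise-Fin3 Adj₂ Adj₂-sym L Z₁ Z₂ (≁-by-meet L Z₁ L⊓Z₁≈0) (≁-by-meet L Z₂ L⊓Z₂≈0) (≁-by-meet Z₁ Z₂ Z₁⊓Z₂≈0)

    zs≉zs : ∀ {i j} → i ≢ j → ¬ zs i ≈₂ zs j
    zs≉zs = pairwise-Fin3 _≈₂_ (λ _ _ (f , g) → g , f) L Z₁ Z₂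
              (≉-sym Z₁ L (≉-by-S Z₁ L (first∈ Z₁) (⟦⟧∉S V) L⊆S))
              (≉-sym Z₂ L (≉-by-S Z₂ L (first∈ Z₂) (⟦⟧∉S V+P₁) L⊆S))
              (≉-sym Z₂ Z₁ (≉-by-member Z₂ Z₁ (first∈ Z₂) v+p₁∉Z₁))

    switched-K113 : InducedK113 (switch Γ₂ C₁ C₂)
    switched-K113 = record
      { x   = X
      ; y   = C
      ; z   = zs
      ; x~y = inj₂ (inj₂ (inj₁ (X∈D , inj₂ C∈C₂ , inj₂ (inj₁ (X-neighbourhood-in-C , C∈C₂)))))
      ; z~x = λ i → inj₂ (inj₁ (zs∈D i , X∈D , zs~X i))
      ; z~y = λ i → inj₂ (inj₂ (inj₁ (zs∈D i , inj₂ C∈C₂ , zs-cross i)))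
      ; z≁z = λ {i} {j} i≢j → zs≁zs i≢j ∘ AdjSw-within-D Γ₂ C₁ C₂ {zs i} {zs j} (zs∈D i) (zs∈D j)
      ; z≉z = zs≉zs
      }

lemma5 : (q : ℕ) → IsPrimePower q →
         (F : CommutativeRing 0ℓ 0ℓ) → IsFiniteField F q →
         (n s : ℕ) → 2 < s → s < n →
         (b : Fin s → LinAlg.Vect F n) → LinAlg.LinIndep F n b →
         (p₁ p₂ : LinAlg.Vect F n) →
         LinAlg.InSpan F n b p₁ → LinAlg.InSpan F n b p₂ →
         ¬ LinAlg.IsZero F n p₁ → ¬ LinAlg.IsZero F n p₂ →
         ¬ LinAlg.InSpan F n (λ (_ : Fin 1) → p₁) p₂ →
         ¬ Iso (LinAlg.Γ₂ F n)
               (switch (LinAlg.Γ₂ F n)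
                       (LinAlg.Cset F n b p₁ p₂)
                       (LinAlg.Cset F n b p₂ p₁))
lemma5 q _ F F-finite n s 2<s s<n b b-indep p₁ p₂ p₁∈S p₂∈S p₁≉0 _ p₂∉⟨p₁⟩ iso =
  ¬¬-steinitz (p₂ ∷ p₁ ∷ []) b 2<s b-indep λ j u∉⟨p₂,p₁⟩ →
  ¬¬-steinitz b 𝕖 s<n 𝕖-independent λ k v∉S →
  Γ₂-has-no-induced-K113 (InducedK113-pullback iso (switched-Γ₂-respects b p₁ p₂)
    (SwitchedConfiguration.switched-K113 𝔽 n b p₁∈S p₂∈S (InSpan-member b j) v∉S p₁≉0 p₂∉⟨p₁⟩ u∉⟨p₂,p₁⟩))
  where
  𝔽 = finite⇒discrete F-finite
  open Vectors F n
  open OverField 𝔽 n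
  open Planes 𝔽 n
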